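{- Let $H$ be a connected bigraph and $S$ a non-trivial strong component of $H^+$. If there is an arc from a vertex of $S$ to a vertex $v\notin S$, then $\{v\}$ is a trivial strong component of $H^+$ which is a sink component; if there is an arc from a vertex $v\notin S$ to a vertex of $S$, then $\{v\}$ is a trivial strong component of $H^+$ which is a source component.
   Context: A bigraph is a bipartite graph $H$ with a fixed bipartition $V(H)=B\cup W$; two vertices have the same colour if they lie in the same part. The pair-digraph $H^+$ has as vertices all ordered pairs $(u,v)$ of distinct vertices of $H$, and arcs: $(u,v)\to(u',v)$ whenever $u,v$ have the same colour, $uu'\in E(H)$ and $vu'\notin E(H)$; and $(u,v)\to(u,v')$ whenever $u,v$ have different colours, $vv'\in E(H)$ and $uv\notin E(H)$. A strong component is trivial if it has exactly one vertex, non-trivial otherwise. A trivial component is a source component if its vertex has in-degree zero in $H^+$, and a sink component if its vertex has out-degree zero in $H^+$. -}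

module Defs where

open import Data.Nat using (ℕ)
open import Data.Fin using (Fin)
open import Data.Bool using (Bool; true; false)
open import Data.Product using (Σ; ∃; _×_; _,_)
open import Relation.Binary.PropositionalEquality using (_≡_; _≢_)
open import Relation.Nullary using (¬_)
open import Relation.Binary.Construct.Closure.ReflexiveTransitive using (Star)
open import Function.Bundles using (_⇔_)

-- A finite bigraph on vertex set Fin n: a simple undirected graph (adjacency
-- given by a symmetric Bool-valued relation) together with a fixed 2-colouring
-- (the bipartition B ∪ W, colour true = B, false = W) such that every edge
-- joins vertices of different colours.
record Bigraph (n : ℕ) : Set where
  field
    colour    : Fin n → Bool
    adj       : Fin n → Fin n → Bool
    adj-sym   : ∀ u v → adj u v ≡ adj v u
    bipartite : ∀ u v → adj u v ≡ true → colour u ≢ colour v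

module _ {n : ℕ} (H : Bigraph n) where
  open Bigraph H

  Edge : Fin n → Fin n → Set
  Edge u v = adj u v ≡ true

  Connected : Set
  Connected = ∀ u v → Star Edge u v

  record PVertex : Set where
    constructor ⟨_,_⟩
    field
      fst : Fin n
      snd : Fin n
      .distinct : fst ≢ snd

  data Arc : PVertex → PVertex → Set where
    arc-same : ∀ {u v u'} .{p : u ≢ v} .{q : u' ≢ v} →
      colour u ≡ colour v → Edge u u' → ¬ Edge v u' →
      Arc (⟨_,_⟩ u v p) (⟨_,_⟩ u' v q)
    arc-diff : ∀ {u v v'} .{p : u ≢ v} .{q : u ≢ v'} →
      colour u ≢ colour v → Edge v v' → ¬ Edge u v →
      Arc (⟨_,_⟩ u v p) (⟨_,_⟩ u v' q)

  Reach : PVertex → PVertex → Set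
  Reach = Star Arc

  StronglyConnected : PVertex → PVertex → Set
  StronglyConnected x y = Reach x y × Reach y x

  IsStrongComponent : (PVertex → Set) → Set
  IsStrongComponent S = ∃ λ x → ∀ y → (S y ⇔ StronglyConnected x y)

  NonTrivial : (PVertex → Set) → Set
  NonTrivial S = ∃ λ a → ∃ λ b → S a × S b × a ≢ b

  TrivialComponent : PVertex → Set
  TrivialComponent v = IsStrongComponent (λ w → w ≡ v)

  IsSink : PVertex → Set
  IsSink v = ∀ w → ¬ Arc v w

  IsSource : PVertex → Set
  IsSource v = ∀ w → ¬ Arc w v

module Submission where

-- Call a vertex (u , v) of H⁺ *monochromatic* when u and v have
-- the same colour.  Arcs leaving a monochromatic vertex are of the first kind
-- (move u), arcs entering it are of the second kind (move v), and every arc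
-- has a monochromatic endpoint.  The key local fact (`turn-around`) is that a
-- directed path  a → b → c  through a monochromatic b can be closed into a
-- cycle:  c = (u' , v) → (u' , t) → (u , t) = a.
--
-- Now let S be a non-trivial strong component, so each of its vertices has an
-- in-arc and an out-arc (`arc-into`, `arc-out-of`).  If an arc s → v left S and
-- v had an out-arc v → w, then s → v → w or z → s → v (z ∈ S) would pass
-- through a monochromatic middle vertex, and turning around would bring v
-- back to S.  Hence v is a sink; dually an arc entering S starts at a source.
-- A sink or a source is alone in its strong component, which gives the
-- corollary.

open import Defs
open import Data.Nat using (ℕ)
open import Data.Bool using (Bool)
open import Data.Bool.Properties using (¬-not)
open import Data.Product using (_×_; _,_; ∃; proj₁; proj₂)
open import Data.Sum using (_⊎_; inj₁; inj₂)
open import Data.Empty using (⊥-elim)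
open import Function using (flip; id)
open import Relation.Nullary using (¬_)
open import Relation.Binary.PropositionalEquality
  using (_≡_; _≢_; refl; sym; trans; subst; cong)
open import Relation.Binary.Construct.Closure.ReflexiveTransitive
  using (Star; ε; _◅_; _◅◅_; reverse)
open import Function.Bundles using (mk⇔; Equivalence)

two-colours : {a b c : Bool} → a ≢ b → b ≢ c → a ≡ c
two-colours a≢b b≢c = trans (¬-not a≢b) (sym (¬-not (λ c≡b → b≢c (sym c≡b))))

-- Two paths from x to distinct endpoints cannot both be empty,
-- so x has an out-going step.
step-out : ∀ {A : Set} {R : A → A → Set} {x a b} →
  Star R x a → Star R x b → a ≢ b → ∃ (R x)
step-out (r ◅ _) _       _   = _ , r
step-out ε       (r ◅ _) _   = _ , r
step-out ε       ε       a≢b = ⊥-elim (a≢b refl)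

step-in : ∀ {A : Set} {R : A → A → Set} {x a b} →
  Star R a x → Star R b x → a ≢ b → ∃ λ z → R z x
step-in {R = R} ax bx = step-out {R = flip R} (reverse id ax) (reverse id bx)

leave-dead-end : ∀ {A : Set} {R : A → A → Set} {x y} →
  (∀ z → ¬ R x z) → Star R x y → x ≡ y
leave-dead-end _    ε       = refl
leave-dead-end stop (r ◅ _) = ⊥-elim (stop _ r)

enter-dead-start : ∀ {A : Set} {R : A → A → Set} {x y} →
  (∀ z → ¬ R z y) → Star R x y → x ≡ y
enter-dead-start {R = R} stop xy =
  sym (leave-dead-end {R = flip R} stop (reverse id xy))

module Local {n : ℕ} (H : Bigraph n) where
  open Bigraph H

  edge-sym : ∀ {u v} → Edge H u v → Edge H v u
  edge-sym {u} {v} e = trans (adj-sym v u) e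

  non-edge-sym : ∀ {u v} → ¬ Edge H u v → ¬ Edge H v u
  non-edge-sym ne e = ne (edge-sym e)

  edge-colours : ∀ {u v} → Edge H u v → colour u ≢ colour v
  edge-colours {u} {v} = bipartite u v

  Monochromatic : PVertex H → Set
  Monochromatic x = colour (PVertex.fst x) ≡ colour (PVertex.snd x)

  arc-meets-monochromatic : ∀ {a b} → Arc H a b →
    Monochromatic a ⊎ Monochromatic b
  arc-meets-monochromatic (arc-same mono _ _) = inj₁ mono
  arc-meets-monochromatic (arc-diff bi e _)   = inj₂ (two-colours bi (edge-colours e))

  -- A two-arc path a → b → c through a monochromatic b returns:
  -- with a = (u , t), b = (u , v), c = (u' , v) we have
  -- c → (u' , t) → a.
  turn-around : ∀ {a b c} → Arc H a b → Arc H b c → Monochromatic b →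
    Reach H c a
  turn-around (arc-same mono e _) _ mono′ =
    ⊥-elim (edge-colours e (trans mono (sym mono′)))
  turn-around _ (arc-diff bi _ _) mono = ⊥-elim (bi mono)
  turn-around (arc-diff {u} {t} {v} bi-ut tv ¬ut) (arc-same {u' = u′} mono uu′ ¬vu′) _ =
    arc-diff {q = u′≢t} u′v-bi (edge-sym tv) (non-edge-sym ¬vu′)
      ◅ arc-same {q = u≢t} u′t-mono (edge-sym uu′) (non-edge-sym ¬ut)
      ◅ ε
    where
    u′≢t : u′ ≢ t
    u′≢t = λ u′≡t → ¬ut (subst (Edge H u) u′≡t uu′)
    u≢t : u ≢ t
    u≢t = λ u≡t → bi-ut (cong colour u≡t)
    u′v-bi : colour u′ ≢ colour v
    u′v-bi = λ u′~v → edge-colours uu′ (trans mono (sym u′~v))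
    u′t-mono : colour u′ ≡ colour t
    u′t-mono = two-colours (edge-colours (edge-sym uu′)) bi-ut

  trivial-component : ∀ v → (∀ y → StronglyConnected H v y → v ≡ y) →
    TrivialComponent H v
  trivial-component v alone =
    v , λ y → mk⇔ (λ { refl → ε , ε }) (λ vy → sym (alone y vy))

  sink-is-trivial : ∀ v → IsSink H v → TrivialComponent H v
  sink-is-trivial v sink =
    trivial-component v λ y vy → leave-dead-end sink (proj₁ vy)

  source-is-trivial : ∀ v → IsSource H v → TrivialComponent H v
  source-is-trivial v source =
    trivial-component v λ y vy → sym (enter-dead-start source (proj₂ vy))

  module Component (S : PVertex H → Set) (comp : IsStrongComponent H S)
                   (nontrivial : NonTrivial H S) where

    centre-to : ∀ {y} → S y → StronglyConnected H (proj₁ comp) y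
    centre-to {y} = Equivalence.to (proj₂ comp y)

    within : ∀ {a x} → S a → S x → Reach H a x
    within Sa Sx = proj₂ (centre-to Sa) ◅◅ proj₁ (centre-to Sx)

    closed : ∀ {s y} → S s → Reach H s y → Reach H y s → S y
    closed {s} {y} Ss sy ys = Equivalence.from (proj₂ comp y)
      (proj₁ (centre-to Ss) ◅◅ sy , ys ◅◅ proj₂ (centre-to Ss))

    arc-into : ∀ {x} → S x → ∃ λ z → Arc H z x
    arc-into Sx =
      let _ , _ , Sa , Sb , a≢b = nontrivial
      in step-in (within Sa Sx) (within Sb Sx) a≢b

    arc-out-of : ∀ {x} → S x → ∃ (Arc H x)
    arc-out-of Sx =
      let _ , _ , Sa , Sb , a≢b = nontrivial
      in step-out (within Sx Sa) (within Sx Sb) a≢b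

    exit-is-sink : ∀ {s v} → S s → ¬ S v → Arc H s v → IsSink H v
    exit-is-sink Ss ∉S sv with arc-meets-monochromatic sv
    ... | inj₁ mono-s with arc-into Ss
    ...   | _ , zs = ⊥-elim (∉S (closed Ss (sv ◅ ε) (turn-around zs sv mono-s ◅◅ zs ◅ ε)))
    exit-is-sink Ss ∉S sv | inj₂ mono-v =
      λ w vw → ∉S (closed Ss (sv ◅ ε) (vw ◅ turn-around sv vw mono-v))

    entry-is-source : ∀ {v s} → S s → ¬ S v → Arc H v s → IsSource H v
    entry-is-source Ss ∉S vs with arc-meets-monochromatic vs
    ... | inj₁ mono-v =
      λ z zv → ∉S (closed Ss (turn-around zv vs mono-v ◅◅ zv ◅ ε) (vs ◅ ε))
    ... | inj₂ mono-s with arc-out-of Ss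
    ...   | _ , sw = ⊥-elim (∉S (closed Ss (sw ◅ turn-around vs sw mono-s) (vs ◅ ε)))

corollary2p7 : {n : ℕ} (H : Bigraph n) → Connected H →
    (S : PVertex H → Set) → IsStrongComponent H S → NonTrivial H S →
    (∀ s v → S s → ¬ S v → Arc H s v →
      TrivialComponent H v × IsSink H v)
    × (∀ v s → S s → ¬ S v → Arc H v s →
      TrivialComponent H v × IsSource H v)
corollary2p7 H _ S comp nontrivial =
  (λ s v Ss ∉S sv → let sink = exit-is-sink Ss ∉S sv in sink-is-trivial v sink , sink)
  , (λ v s Ss ∉S vs → let source = entry-is-source Ss ∉S vs in source-is-trivial v source , source)
  where
  open Local H
  open Component S comp nontrivial
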